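{- Let $G=(V,E)$ be a loop-free multigraph and, for each $v\in V$, let $\varphi_v:\mathbb{Z}_+\to\mathbb{R}$ be a discrete linear function $\varphi_v(z)=a_vz+b_v$ with $a_v,b_v\in\mathbb{R}$. Then any vertex order in which the vertices appear in non-increasing order of the slopes $a_v$ minimizes $\sum_{v\in V}\varphi_v(\overleftarrow{d}(v))$ over all vertex orders of $G$.
   Context: A vertex order is a linear ordering $\sigma=(\sigma_1,\dots,\sigma_n)$ of $V$; the left-degree $\overleftarrow{d}(v)$ of $v=\sigma_i$ is the number of edges (with multiplicity) joining $v$ to $\{\sigma_1,\dots,\sigma_{i-1}\}$. -}

module Defs where

open import Level using (Level; _⊔_) renaming (suc to lsuc)
open import Data.Nat using (ℕ; zero; suc)
open import Data.Fin using (Fin; _<_) renaming (zero to fzero; suc to fsuc)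
import Data.Fin as F
open import Data.Fin.Permutation using (Permutation′; _⟨$⟩ʳ_; _⟨$⟩ˡ_)
open import Data.Product using (_×_; _,_; proj₁; proj₂)
open import Data.List using (List; []; _∷_)
open import Data.List.Relation.Unary.All using (All)
open import Relation.Binary.Core using (Rel)
open import Relation.Binary.Structures using (IsTotalOrder)
open import Relation.Binary.PropositionalEquality using (_≡_; _≢_)
open import Relation.Nullary using (yes; no)
open import Relation.Nullary.Decidable using (_×-dec_)
open import Algebra.Bundles using (CommutativeRing)

-- An ordered commutative ring (the real numbers are an instance):
-- a commutative ring with a total order compatible with + and
-- such that products of non-negative elements are non-negative.
record OrderedCommutativeRing (c ℓ₁ ℓ₂ : Level) : Set (lsuc (c ⊔ ℓ₁ ⊔ ℓ₂)) where
  field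
    commutativeRing : CommutativeRing c ℓ₁
  open CommutativeRing commutativeRing public
  field
    _≤_          : Rel Carrier ℓ₂
    isTotalOrder : IsTotalOrder _≈_ _≤_
    +-mono-≤     : ∀ {x y} z → x ≤ y → (x + z) ≤ (y + z)
    *-nonneg     : ∀ {x y} → 0# ≤ x → 0# ≤ y → 0# ≤ (x * y)

-- A loop-free multigraph on vertex set Fin n: a list of edges
-- (repetition = multiplicity), no edge joins a vertex to itself.
record LoopFreeMultigraph (n : ℕ) : Set where
  field
    edges    : List (Fin n × Fin n)
    loopFree : All (λ e → proj₁ e ≢ proj₂ e) edges
open LoopFreeMultigraph public

-- A vertex order σ : position ↦ vertex; σ ⟨$⟩ʳ i is σ_i,
-- and σ ⟨$⟩ˡ v is the position of v.
VertexOrder : ℕ → Set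
VertexOrder n = Permutation′ n

position : ∀ {n} → VertexOrder n → Fin n → Fin n
position σ v = σ ⟨$⟩ˡ v

-- number of edge-ends at v of edge (x , y) whose other end is before v
endCount : ∀ {n} → VertexOrder n → Fin n → Fin n × Fin n → ℕ
endCount σ v (x , y) with (x F.≟ v) ×-dec (position σ y F.<? position σ v)
                         | (y F.≟ v) ×-dec (position σ x F.<? position σ v)
... | yes _ | yes _ = 2
... | yes _ | no  _ = 1
... | no  _ | yes _ = 1
... | no  _ | no  _ = 0

leftDegreeList : ∀ {n} → VertexOrder n → Fin n → List (Fin n × Fin n) → ℕ
leftDegreeList σ v []       = 0
leftDegreeList σ v (e ∷ es) = endCount σ v e Data.Nat.+ leftDegreeList σ v es

leftDegree : ∀ {n} → LoopFreeMultigraph n → VertexOrder n → Fin n → ℕ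
leftDegree G σ v = leftDegreeList σ v (edges G)

module _ {c ℓ₁ ℓ₂} (R : OrderedCommutativeRing c ℓ₁ ℓ₂) where
  open OrderedCommutativeRing R

  fromℕ : ℕ → Carrier
  fromℕ zero    = 0#
  fromℕ (suc k) = 1# + fromℕ k

  sumFin : ∀ {n} → (Fin n → Carrier) → Carrier
  sumFin {zero}  f = 0#
  sumFin {suc n} f = f fzero + sumFin (λ i → f (fsuc i))

  linFun : Carrier → Carrier → ℕ → Carrier
  linFun a b z = (a * fromℕ z) + b

  cost : ∀ {n} → LoopFreeMultigraph n → (Fin n → Carrier) → (Fin n → Carrier)
       → VertexOrder n → Carrier
  cost G a b σ = sumFin (λ v → linFun (a v) (b v) (leftDegree G σ v))

  NonIncreasingSlopes : ∀ {n} → (Fin n → Carrier) → VertexOrder n → Set ℓ₂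
  NonIncreasingSlopes a σ = ∀ i j → i F.≤ j → a (σ ⟨$⟩ʳ j) ≤ a (σ ⟨$⟩ʳ i)

{-# OPTIONS --safe #-}
module Submission where

-- Expand the cost as a sum over edges: an edge contributes the slope of
-- whichever endpoint comes later in the order, plus the constant Σ b_v.
-- An order with non-increasing slopes places the endpoint of smaller
-- slope last, so each edge contributes as little as it can under any order.

open import Defs
open import Data.Nat using (ℕ; zero; suc) renaming (_+_ to _+ℕ_)
import Data.Nat.Properties as ℕ
open import Data.Fin using (Fin; _<_; _<?_) renaming (_≤_ to _≤ᶠ_; zero to fzero; suc to fsuc)
open import Data.Fin.Properties using (suc-injective; <-irrefl; <-asym; ≤∧≢⇒<; _≟_)
open import Data.Fin.Permutation using (_⟨$⟩ʳ_; inverseʳ)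
open import Data.Product using (_×_; _,_; proj₁; proj₂)
open import Data.Sum using (_⊎_; inj₁; inj₂)
open import Data.List using (List; []; _∷_)
open import Data.List.Relation.Unary.All using (All; []; _∷_)
open import Relation.Binary.PropositionalEquality as ≡ using (_≡_; _≢_)
open import Relation.Binary.Bundles using (Poset)
open import Relation.Binary.Structures using (IsTotalOrder)
open import Relation.Nullary using (yes; no)
open import Relation.Nullary.Decidable using (_×-dec_)
open import Data.Empty using (⊥-elim)
open import Function using (_∘′_)
open import Algebra.Properties.CommutativeSemigroup using (interchange)
import Relation.Binary.Reasoning.Setoid as ≈-Reasoning
import Relation.Binary.Reasoning.PartialOrder as ≤-Reasoning

module _ {n : ℕ} (σ : VertexOrder n) where

  position-injective : ∀ {x y} → position σ x ≡ position σ y → x ≡ y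
  position-injective {x} {y} eq = begin
    x                    ≡⟨ ≡.sym (inverseʳ σ) ⟩
    σ ⟨$⟩ʳ position σ x  ≡⟨ ≡.cong (σ ⟨$⟩ʳ_) eq ⟩
    σ ⟨$⟩ʳ position σ y  ≡⟨ inverseʳ σ ⟩
    y                    ∎
    where open ≡.≡-Reasoning

  endCount-swap : ∀ v x y → endCount σ v (x , y) ≡ endCount σ v (y , x)
  endCount-swap v x y
    with (x ≟ v) ×-dec (position σ y <? position σ v)
       | (y ≟ v) ×-dec (position σ x <? position σ v)
  ... | yes _ | yes _ = ≡.refl
  ... | yes _ | no  _ = ≡.refl
  ... | no  _ | yes _ = ≡.refl
  ... | no  _ | no  _ = ≡.refl

  module _ {x y : Fin n} (x<y : position σ x < position σ y) where

    endCount-later : endCount σ y (x , y) ≡ 1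
    endCount-later
      with (x ≟ y) ×-dec (position σ y <? position σ y)
         | (y ≟ y) ×-dec (position σ x <? position σ y)
    ... | yes (≡.refl , _) | _             = ⊥-elim (<-irrefl ≡.refl x<y)
    ... | no _             | yes _         = ≡.refl
    ... | no _             | no ¬y-after-x = ⊥-elim (¬y-after-x (≡.refl , x<y))

    endCount-other : ∀ {v} → v ≢ y → endCount σ v (x , y) ≡ 0
    endCount-other {v} v≢y
      with (x ≟ v) ×-dec (position σ y <? position σ v)
         | (y ≟ v) ×-dec (position σ x <? position σ v)
    ... | _                  | yes (y≡v , _) = ⊥-elim (v≢y (≡.sym y≡v))
    ... | yes (≡.refl , y<x) | no _          = ⊥-elim (<-asym x<y y<x)
    ... | no _               | no _          = ≡.refl

  later : Fin n → Fin n → Fin n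
  later x y with position σ x <? position σ y
  ... | yes _ = y
  ... | no  _ = x

  later-endpoint : ∀ x y → later x y ≡ x ⊎ later x y ≡ y
  later-endpoint x y with position σ x <? position σ y
  ... | yes _ = inj₂ ≡.refl
  ... | no  _ = inj₁ ≡.refl

module _ {c ℓ₁ ℓ₂} (R : OrderedCommutativeRing c ℓ₁ ℓ₂) where
  open OrderedCommutativeRing R
  open IsTotalOrder isTotalOrder using (isPartialOrder) renaming (refl to ≤-refl)

  poset : Poset c ℓ₁ ℓ₂
  poset = record { isPartialOrder = isPartialOrder }

  +-mono₂-≤ : ∀ {x x′ y y′} → x ≤ x′ → y ≤ y′ → (x + y) ≤ (x′ + y′)
  +-mono₂-≤ {x} {x′} {y} {y′} x≤x′ y≤y′ = begin
    x + y    ≤⟨ +-mono-≤ y x≤x′ ⟩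
    x′ + y   ≈⟨ +-comm x′ y ⟩
    y + x′   ≤⟨ +-mono-≤ x′ y≤y′ ⟩
    y′ + x′  ≈⟨ +-comm y′ x′ ⟩
    x′ + y′  ∎
    where open ≤-Reasoning poset

  fromℕ-+ : ∀ m k → fromℕ R (m +ℕ k) ≈ fromℕ R m + fromℕ R k
  fromℕ-+ zero    k = sym (+-identityˡ _)
  fromℕ-+ (suc m) k = trans (+-cong refl (fromℕ-+ m k)) (sym (+-assoc _ _ _))

  *-fromℕ-1 : ∀ x → x * fromℕ R 1 ≈ x
  *-fromℕ-1 x = trans (*-cong refl (+-identityʳ 1#)) (*-identityʳ x)

  sumFin-cong : ∀ {m} {f g : Fin m → Carrier} → (∀ i → f i ≈ g i) → sumFin R f ≈ sumFin R g
  sumFin-cong {zero}  f≈g = refl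
  sumFin-cong {suc m} f≈g = +-cong (f≈g fzero) (sumFin-cong (λ i → f≈g (fsuc i)))

  sumFin-zero : ∀ {m} {f : Fin m → Carrier} → (∀ i → f i ≈ 0#) → sumFin R f ≈ 0#
  sumFin-zero {zero}  f≈0 = refl
  sumFin-zero {suc m} f≈0 =
    trans (+-cong (f≈0 fzero) (sumFin-zero (λ i → f≈0 (fsuc i)))) (+-identityˡ 0#)

  sumFin-+ : ∀ {m} (f g : Fin m → Carrier) → sumFin R (λ i → f i + g i) ≈ sumFin R f + sumFin R g
  sumFin-+ {zero}  f g = sym (+-identityˡ 0#)
  sumFin-+ {suc m} f g =
    trans (+-cong refl (sumFin-+ (λ i → f (fsuc i)) (λ i → g (fsuc i))))
          (interchange +-commutativeSemigroup (f fzero) (g fzero) _ _)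

  sumFin-single : ∀ {m} (f : Fin m → Carrier) (w : Fin m) → (∀ i → i ≢ w → f i ≈ 0#) → sumFin R f ≈ f w
  sumFin-single f fzero f≈0 =
    trans (+-cong refl (sumFin-zero (λ i → f≈0 (fsuc i) (λ ())))) (+-identityʳ _)
  sumFin-single f (fsuc w) f≈0 =
    trans (+-cong (f≈0 fzero (λ ()))
                  (sumFin-single (λ i → f (fsuc i)) w (λ i i≢w → f≈0 (fsuc i) (i≢w ∘′ suc-injective))))
          (+-identityˡ _)

  module _ {n : ℕ} (a : Fin n → Carrier) where

    edgeCost : VertexOrder n → Fin n × Fin n → Carrier
    edgeCost σ e = sumFin R (λ v → a v * fromℕ R (endCount σ v e))

    edgeCost-swap : ∀ σ x y → edgeCost σ (x , y) ≈ edgeCost σ (y , x)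
    edgeCost-swap σ x y =
      sumFin-cong (λ v → reflexive (≡.cong (λ k → a v * fromℕ R k) (endCount-swap σ v x y)))

    edgeCost-ordered : ∀ σ {x y} → position σ x < position σ y → edgeCost σ (x , y) ≈ a y
    edgeCost-ordered σ {x} {y} x<y = begin
      edgeCost σ (x , y)                    ≈⟨ sumFin-single _ y only-y-counts ⟩
      a y * fromℕ R (endCount σ y (x , y))  ≡⟨ ≡.cong (λ k → a y * fromℕ R k) (endCount-later σ x<y) ⟩
      a y * fromℕ R 1                       ≈⟨ *-fromℕ-1 (a y) ⟩
      a y                                   ∎
      where
      open ≈-Reasoning setoid
      only-y-counts : ∀ v → v ≢ y → a v * fromℕ R (endCount σ v (x , y)) ≈ 0#
      only-y-counts v v≢y =
        trans (reflexive (≡.cong (λ k → a v * fromℕ R k) (endCount-other σ x<y v≢y))) (zeroʳ (a v))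

    edgeCost-later : ∀ σ {x y} → x ≢ y → edgeCost σ (x , y) ≈ a (later σ x y)
    edgeCost-later σ {x} {y} x≢y with position σ x <? position σ y
    ... | yes x<y = edgeCost-ordered σ x<y
    ... | no  x≮y = trans (edgeCost-swap σ x y) (edgeCost-ordered σ y<x)
      where
      y<x : position σ y < position σ x
      y<x = ≤∧≢⇒< (ℕ.≮⇒≥ x≮y) (x≢y ∘′ position-injective σ ∘′ ≡.sym)

    module _ {σ : VertexOrder n} (nonIncreasing : NonIncreasingSlopes R a σ) where

      slope-antitone : ∀ {x y} → position σ x ≤ᶠ position σ y → a y ≤ a x
      slope-antitone px≤py =
        ≡.subst₂ (λ u v → a u ≤ a v) (inverseʳ σ) (inverseʳ σ) (nonIncreasing _ _ px≤py)

      later-slope-minimal : ∀ x y → (a (later σ x y) ≤ a x) × (a (later σ x y) ≤ a y)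
      later-slope-minimal x y with position σ x <? position σ y
      ... | yes x<y = slope-antitone (ℕ.<⇒≤ x<y) , ≤-refl
      ... | no  x≮y = ≤-refl , slope-antitone (ℕ.≮⇒≥ x≮y)

      edgeCost-minimal : ∀ τ {x y} → x ≢ y → edgeCost σ (x , y) ≤ edgeCost τ (x , y)
      edgeCost-minimal τ {x} {y} x≢y = begin
        edgeCost σ (x , y)  ≈⟨ edgeCost-later σ x≢y ⟩
        a (later σ x y)     ≤⟨ below-later-τ ⟩
        a (later τ x y)     ≈⟨ edgeCost-later τ x≢y ⟨
        edgeCost τ (x , y)  ∎
        where
        open ≤-Reasoning poset
        below-later-τ : a (later σ x y) ≤ a (later τ x y)
        below-later-τ with later τ x y | later-endpoint τ x y
        ... | _ | inj₁ ≡.refl = proj₁ (later-slope-minimal x y)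
        ... | _ | inj₂ ≡.refl = proj₂ (later-slope-minimal x y)

    weightedLeftDegree : VertexOrder n → List (Fin n × Fin n) → Carrier
    weightedLeftDegree σ es = sumFin R (λ v → a v * fromℕ R (leftDegreeList σ v es))

    weightedLeftDegree-[] : ∀ σ → weightedLeftDegree σ [] ≈ 0#
    weightedLeftDegree-[] σ = sumFin-zero (λ v → zeroʳ (a v))

    weightedLeftDegree-∷ : ∀ σ e es →
      weightedLeftDegree σ (e ∷ es) ≈ edgeCost σ e + weightedLeftDegree σ es
    weightedLeftDegree-∷ σ e es = begin
      sumFin R (λ v → a v * fromℕ R (endCount σ v e +ℕ leftDegreeList σ v es))
        ≈⟨ sumFin-cong (λ v → *-congˡ (fromℕ-+ (endCount σ v e) (leftDegreeList σ v es))) ⟩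
      sumFin R (λ v → a v * (fromℕ R (endCount σ v e) + fromℕ R (leftDegreeList σ v es)))
        ≈⟨ sumFin-cong (λ v → distribˡ (a v) _ _) ⟩
      sumFin R (λ v → a v * fromℕ R (endCount σ v e) + a v * fromℕ R (leftDegreeList σ v es))
        ≈⟨ sumFin-+ (λ v → a v * fromℕ R (endCount σ v e))
                    (λ v → a v * fromℕ R (leftDegreeList σ v es)) ⟩
      edgeCost σ e + weightedLeftDegree σ es
        ∎
      where open ≈-Reasoning setoid

    weightedLeftDegree-minimal : ∀ {σ} → NonIncreasingSlopes R a σ → ∀ τ es →
      All (λ e → proj₁ e ≢ proj₂ e) es → weightedLeftDegree σ es ≤ weightedLeftDegree τ es
    weightedLeftDegree-minimal {σ} nonIncreasing τ [] [] = begin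
      weightedLeftDegree σ []  ≈⟨ weightedLeftDegree-[] σ ⟩
      0#                       ≈⟨ weightedLeftDegree-[] τ ⟨
      weightedLeftDegree τ []  ∎
      where open ≤-Reasoning poset
    weightedLeftDegree-minimal {σ} nonIncreasing τ (e ∷ es) (loopless ∷ allLoopless) = begin
      weightedLeftDegree σ (e ∷ es)             ≈⟨ weightedLeftDegree-∷ σ e es ⟩
      edgeCost σ e + weightedLeftDegree σ es    ≤⟨ +-mono₂-≤ (edgeCost-minimal nonIncreasing τ loopless)
                                                     (weightedLeftDegree-minimal nonIncreasing τ es allLoopless) ⟩
      edgeCost τ e + weightedLeftDegree τ es    ≈⟨ weightedLeftDegree-∷ τ e es ⟨
      weightedLeftDegree τ (e ∷ es)             ∎
      where open ≤-Reasoning poset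

    cost-split : ∀ G b σ → cost R G a b σ ≈ weightedLeftDegree σ (edges G) + sumFin R b
    cost-split G b σ = sumFin-+ (λ v → a v * fromℕ R (leftDegree G σ v)) b

theorem5 : ∀ {c ℓ₁ ℓ₂} (R : OrderedCommutativeRing c ℓ₁ ℓ₂) (n : ℕ)
             (G : LoopFreeMultigraph n)
             (a b : Fin n → OrderedCommutativeRing.Carrier R)
             (σ : VertexOrder n)
           → NonIncreasingSlopes R a σ
           → (τ : VertexOrder n)
           → OrderedCommutativeRing._≤_ R (cost R G a b σ) (cost R G a b τ)
theorem5 R n G a b σ nonIncreasing τ = begin
  cost R G a b σ                                        ≈⟨ cost-split R a G b σ ⟩
  weightedLeftDegree R a σ (edges G) + sumFin R b       ≤⟨ +-mono-≤ (sumFin R b) edgesMinimal ⟩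
  weightedLeftDegree R a τ (edges G) + sumFin R b       ≈⟨ cost-split R a G b τ ⟨
  cost R G a b τ                                        ∎
  where
  open OrderedCommutativeRing R
  open ≤-Reasoning (poset R)
  edgesMinimal : weightedLeftDegree R a σ (edges G) ≤ weightedLeftDegree R a τ (edges G)
  edgesMinimal = weightedLeftDegree-minimal R a nonIncreasing τ (edges G) (loopFree G)
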